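{- For any graph $G$ and any $v_0\in V(G)$, $$\sum_{v\in N[v_0]} DV_G(v)\le \tau(G)\cdot(1+\deg_G(v_0)),$$ and the bound is sharp, i.e., it is attained with equality for some graph $G$ and vertex $v_0$.
   Context: All graphs are finite, simple and undirected. $N[v_0]$ is the closed neighborhood of $v_0$ and $\deg_G(v_0)$ its degree. A set $D\subseteq V(G)$ is a dominating set of $G$ if every vertex not in $D$ is adjacent to at least one vertex of $D$. The domination number $\gamma(G)$ is the minimum cardinality of a dominating set; a dominating set of cardinality $\gamma(G)$ is a $\gamma(G)$-set. $\tau(G)$ denotes the total number of $\gamma(G)$-sets, and for $v\in V(G)$, $DV_G(v)$ is the number of $\gamma(G)$-sets containing $v$. -}

module Defs where

open import Data.Bool using (Bool; true; false; _∧_; _∨_; not; if_then_else_)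
open import Data.Nat using (ℕ; zero; suc; _+_; _*_; _≤ᵇ_)
open import Data.Fin using (Fin; _≟_)
open import Data.Fin.Subset using (Subset; ∣_∣)
open import Data.Vec using (Vec; []; _∷_; lookup)
open import Data.List using (List; []; _∷_; _++_; map; allFin; length; filter)
open import Data.Bool.ListAction using (all; any)
open import Data.Nat.ListAction using (sum)
open import Relation.Binary.PropositionalEquality using (_≡_)
open import Relation.Nullary.Decidable using (⌊_⌋)
open import Relation.Unary using (Pred)

record Graph (n : ℕ) : Set where
  field
    adj    : Fin n → Fin n → Bool
    sym    : ∀ u v → adj u v ≡ adj v u
    irrefl : ∀ v → adj v v ≡ false
open Graph public

-- All subsets of Fin n (each exactly once).
allSubsets : (n : ℕ) → List (Subset n)
allSubsets zero    = [] ∷ []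
allSubsets (suc n) = map (true ∷_) (allSubsets n) ++ map (false ∷_) (allSubsets n)

countB : ∀ {A : Set} → (A → Bool) → List A → ℕ
countB p xs = length (filter (λ x → Data.Bool._≟_ (p x) true) xs)
  where import Data.Bool

isDominating : ∀ {n} → Graph n → Subset n → Bool
isDominating {n} G D =
  all (λ v → lookup D v ∨ any (λ u → lookup D u ∧ adj G u v) (allFin n)) (allFin n)

isGammaSet : ∀ {n} → Graph n → Subset n → Bool
isGammaSet {n} G D =
  isDominating G D ∧
  all (λ D' → not (isDominating G D') ∨ (∣ D ∣ ≤ᵇ ∣ D' ∣)) (allSubsets n)

τ : ∀ {n} → Graph n → ℕ
τ {n} G = countB (isGammaSet G) (allSubsets n)

DV : ∀ {n} → Graph n → Fin n → ℕ
DV {n} G v = countB (λ D → isGammaSet G D ∧ lookup D v) (allSubsets n)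

deg : ∀ {n} → Graph n → Fin n → ℕ
deg {n} G v = countB (adj G v) (allFin n)

inClosedNbhd : ∀ {n} → Graph n → Fin n → Fin n → Bool
inClosedNbhd G v0 v = ⌊ v ≟ v0 ⌋ ∨ adj G v0 v

sumDVClosedNbhd : ∀ {n} → Graph n → Fin n → ℕ
sumDVClosedNbhd {n} G v0 =
  sum (map (DV G) (filter (λ v → Data.Bool._≟_ (inClosedNbhd G v0 v) true) (allFin n)))
  where import Data.Bool

module Submission where

open import Defs
open import Data.Nat using (ℕ; suc; _+_; _*_; _≤_; z≤n; s≤s)
open import Data.Nat.Properties
  using (≤-trans; ≤-reflexive; n≤1+n; m≤n⇒m≤1+n; +-suc; +-mono-≤; +-monoʳ-≤; *-suc; *-monoʳ-≤; module ≤-Reasoning)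
open import Data.Nat.ListAction using (sum)
open import Data.Bool as Bool using (Bool; true; false; _∧_; _∨_)
open import Data.Fin using (Fin; zero; suc; _≟_)
open import Data.List using (List; []; _∷_; map; filter; length; allFin; tabulate)
open import Data.List.Properties using (map-tabulate)
open import Data.Product using (_×_; Σ; _,_)
open import Data.Vec using (lookup)
open import Function using (id; _∘_; const)
open import Relation.Binary.PropositionalEquality as ≡ using (_≡_; refl; cong)
open import Relation.Nullary using (yes; no)
open import Relation.Nullary.Decidable using (⌊_⌋)

-- Each DV(v) counts the γ-sets satisfying an extra condition, so DV(v) ≤ τ, and
-- N[v₀] has at most 1 + deg(v₀) vertices; summing gives the bound. Equality holds
-- for the one-vertex graph, whose unique γ-set is the whole vertex set.

module _ {A : Set} where

  countB-map : ∀ {C : Set} (p : C → Bool) (f : A → C) (xs : List A) →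
    countB p (map f xs) ≡ countB (p ∘ f) xs
  countB-map p f [] = refl
  countB-map p f (x ∷ xs) with p (f x)
  ... | true  = cong suc (countB-map p f xs)
  ... | false = countB-map p f xs

  countB-cong : {p q : A → Bool} → (∀ x → p x ≡ q x) → (xs : List A) → countB p xs ≡ countB q xs
  countB-cong p≗q [] = refl
  countB-cong {p} {q} p≗q (x ∷ xs) with p x | q x | p≗q x
  ... | true  | true  | refl = cong suc (countB-cong p≗q xs)
  ... | false | false | refl = countB-cong p≗q xs

  countB-const-false : (xs : List A) → countB (const false) xs ≡ 0
  countB-const-false []       = refl
  countB-const-false (_ ∷ xs) = countB-const-false xs

  countB-∧-≤ : (p q : A → Bool) (xs : List A) →
    countB (λ x → p x ∧ q x) xs ≤ countB p xs
  countB-∧-≤ p q [] = z≤n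
  countB-∧-≤ p q (x ∷ xs) with p x | q x
  ... | true  | true  = s≤s (countB-∧-≤ p q xs)
  ... | true  | false = m≤n⇒m≤1+n (countB-∧-≤ p q xs)
  ... | false | _     = countB-∧-≤ p q xs

  countB-∨-≤ : (p q : A → Bool) (xs : List A) →
    countB (λ x → p x ∨ q x) xs ≤ countB p xs + countB q xs
  countB-∨-≤ p q [] = z≤n
  countB-∨-≤ p q (x ∷ xs) with p x | q x
  ... | true  | true  = s≤s (≤-trans (countB-∨-≤ p q xs) (+-monoʳ-≤ (countB p xs) (n≤1+n _)))
  ... | true  | false = s≤s (countB-∨-≤ p q xs)
  ... | false | true  = ≤-trans (s≤s (countB-∨-≤ p q xs)) (≤-reflexive (≡.sym (+-suc _ _)))
  ... | false | false = countB-∨-≤ p q xs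

sum-map-≤ : ∀ {A : Set} (f : A → ℕ) {t : ℕ} → (∀ x → f x ≤ t) → (xs : List A) →
  sum (map f xs) ≤ t * length xs
sum-map-≤ f f≤t [] = z≤n
sum-map-≤ f {t} f≤t (x ∷ xs) rewrite *-suc t (length xs) = +-mono-≤ (f≤t x) (sum-map-≤ f f≤t xs)

countB-tabulate : ∀ {A : Set} {m} (p : A → Bool) (f : Fin m → A) →
  countB p (tabulate f) ≡ countB (p ∘ f) (allFin m)
countB-tabulate p f = ≡.trans (cong (countB p) (≡.sym (map-tabulate id f))) (countB-map p f (allFin _))

-- Not definitional: `does (map′ _ _ d)` only reduces once `d` is a constructor.
suc-≟-suc : ∀ {m} (v w : Fin m) → ⌊ suc v ≟ suc w ⌋ ≡ ⌊ v ≟ w ⌋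
suc-≟-suc v w with v ≟ w
... | yes _ = refl
... | no  _ = refl

countB-≟ : ∀ {m} (v₀ : Fin m) → countB (λ v → ⌊ v ≟ v₀ ⌋) (allFin m) ≡ 1
countB-≟ {suc m} zero =
  cong suc (≡.trans (countB-tabulate (λ v → ⌊ v ≟ zero ⌋) (suc {m})) (countB-const-false (allFin m)))
countB-≟ {suc m} (suc w) = begin
  countB (λ v → ⌊ v ≟ suc w ⌋) (tabulate suc)     ≡⟨ countB-tabulate (λ v → ⌊ v ≟ suc w ⌋) suc ⟩
  countB (λ v → ⌊ suc v ≟ suc w ⌋) (allFin m)     ≡⟨ countB-cong (λ v → suc-≟-suc v w) (allFin m) ⟩
  countB (λ v → ⌊ v ≟ w ⌋) (allFin m)             ≡⟨ countB-≟ w ⟩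
  1                                               ∎
  where open ≡.≡-Reasoning

closedNbhd-size-≤ : ∀ {n} (G : Graph n) (v₀ : Fin n) →
  countB (inClosedNbhd G v₀) (allFin n) ≤ 1 + deg G v₀
closedNbhd-size-≤ {n} G v₀ = ≤-trans (countB-∨-≤ _ (adj G v₀) (allFin n))
  (≤-reflexive (cong (_+ deg G v₀) (countB-≟ v₀)))

DV≤τ : ∀ {n} (G : Graph n) (v : Fin n) → DV G v ≤ τ G
DV≤τ {n} G v = countB-∧-≤ (isGammaSet G) (λ D → lookup D v) (allSubsets n)

sumDVClosedNbhd-≤ : ∀ {n} (G : Graph n) (v₀ : Fin n) →
  sumDVClosedNbhd G v₀ ≤ τ G * (1 + deg G v₀)
sumDVClosedNbhd-≤ {n} G v₀ = begin
  sum (map (DV G) N[v₀])                          ≤⟨ sum-map-≤ (DV G) (DV≤τ G) N[v₀] ⟩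
  τ G * countB (inClosedNbhd G v₀) (allFin n)     ≤⟨ *-monoʳ-≤ (τ G) (closedNbhd-size-≤ G v₀) ⟩
  τ G * (1 + deg G v₀)                            ∎
  where
  open ≤-Reasoning
  N[v₀] : List (Fin n)
  N[v₀] = filter (λ v → inClosedNbhd G v₀ v Bool.≟ true) (allFin n)

K₁ : Graph 1
K₁ = record { adj = λ _ _ → false ; sym = λ _ _ → refl ; irrefl = λ _ → refl }

proposition2p5 :
    ((n : ℕ) (G : Graph n) (v₀ : Fin n) → sumDVClosedNbhd G v₀ ≤ τ G * (1 + deg G v₀))
    × Σ ℕ (λ n → Σ (Graph n) (λ G → Σ (Fin n) (λ v₀ →
        sumDVClosedNbhd G v₀ ≡ τ G * (1 + deg G v₀))))
proposition2p5 = (λ _ → sumDVClosedNbhd-≤) , (1 , K₁ , zero , refl)
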